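{- Let $X=(x_1,\dots,x_n)$ be a permutation of $[n]$ and let $\mathcal{P}$ be a set of unordered pairs of elements of $[n]$. There is a stable heap algorithm $\mathcal{A}$ with $\mathcal{A}(X)=\mathcal{P}$ if and only if there is an algorithm $\mathcal{B}$ for the star-path problem on the point set $P^{X'}=\{\langle i,x_i\rangle : i\in[n]\}$ such that $\mathcal{B}(P^{X'})=\mathcal{P}$, where each point of $P^{X'}$ is identified with its $y$-coordinate.
   Context: $X'$ denotes the inverse permutation ($X'=(y_1,\dots,y_n)$ with $y_i=j$ iff $x_j=i$), and $P^{Y}=\{\langle y_i,i\rangle\}$ for a permutation $Y$; thus $P^{X'}=\{\langle i,x_i\rangle\}$. Stable heap algorithms (sorting mode): a forest of ordered, heap-ordered trees with distinct keys and an ordered top-level list of roots. A stable link of neighboring roots $x$ (left), $y$ (right): if $x<y$, $y$ leaves the list and becomes the rightmost child of $x$; otherwise $x$ leaves the list and becomes the leftmost child of $y$. On input $X$, the top-level list is initially the singletons $x_1,\dots,x_n$; then $n$ extract-min operations are performed, each consisting of stable links of neighboring top-level roots, chosen arbitrarily, until one root remains; it is deleted and its children, in left-to-right order, become the new top-level list. $\mathcal{A}(X)$ is the set of pairs of keys linked during the execution. Star-path problem: let $P\subseteq[n]\times[n]$ be a permutation point set (exactly one point in each row and column $i\in[n]$) and $P_0=P\cup\{\langle0,0\rangle\}$. A monotone tree is a tree on $P_0$ rooted at $\langle0,0\rangle$ in which every parent has smaller $y$-coordinate than its child. $star(P)$ is the monotone tree where every point of $P$ is a child of $\langle0,0\rangle$;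 $path(P)$ is the path $\langle0,0\rangle,p_{y=1},\dots,p_{y=n}$. A link of two siblings $a,b$ that are neighbors in the $x$-ordering of the children of their parent $u$: if $a.y>b.y$, the parent of $a$ is changed from $u$ to $b$; otherwise the parent of $b$ is changed to $a$. An algorithm for the star-path problem transforms $star(P)$ into $path(P)$ by a sequence of links; $\mathcal{B}(P)$ is the set of pairs of points it links. -}

module Defs where

open import Data.Nat using (ℕ; zero; suc; _<_; _≤_; _<ᵇ_; _≡ᵇ_)
open import Data.Bool using (if_then_else_)
open import Data.List using (List; []; _∷_; _++_; map; upTo; lookup; length)
open import Data.Product using (_×_; _,_; proj₁; proj₂; Σ)
open import Data.Sum using (_⊎_)
open import Relation.Binary.PropositionalEquality using (_≡_; _≢_)
open import Relation.Nullary using (¬_)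
open import Data.List.Membership.Propositional using (_∈_)
open import Data.List.Relation.Binary.Permutation.Propositional using (_↭_)
open import Data.List.Relation.Unary.All using (All)
open import Function.Bundles using (_⇔_)

-- Permutations of [n] = {1,…,n}, given as the list (x₁,…,xₙ)

range1 : ℕ → List ℕ
range1 n = map suc (upTo n)

IsPermOf : ℕ → List ℕ → Set
IsPermOf n X = X ↭ range1 n

In[n] : ℕ → ℕ → Set
In[n] n a = 1 ≤ a × a ≤ n

-- Sets of unordered pairs, represented by lists of ordered pairs,
-- compared as sets of unordered pairs.

UMem : ℕ → ℕ → List (ℕ × ℕ) → Set
UMem a b L = (a , b) ∈ L ⊎ (b , a) ∈ L

SamePairs : List (ℕ × ℕ) → List (ℕ × ℕ) → Set
SamePairs L M = ∀ a b → UMem a b L ⇔ UMem a b M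

data Tree : Set where
  node : ℕ → List Tree → Tree

root : Tree → ℕ
root (node x _) = x

children : Tree → List Tree
children (node _ cs) = cs

stableLink : Tree → Tree → Tree
stableLink (node x cs) (node y ds) =
  if x <ᵇ y then node x (cs ++ (node y ds ∷ [])) else node y (node x cs ∷ ds)

-- HeapRun ts ps : starting from top-level list ts, an execution
-- (links of neighbouring roots chosen arbitrarily; when exactly one root
-- remains it is deleted and its children become the top-level list)
-- runs until the forest is empty, linking the pairs ps in this order.
data HeapRun : List Tree → List (ℕ × ℕ) → Set where
  finished : HeapRun [] []
  link : ∀ {ts ps} (l r : List Tree) (s t : Tree) →
         ts ≡ l ++ (s ∷ t ∷ r) →
         HeapRun (l ++ (stableLink s t ∷ r)) ps →
         HeapRun ts ((root s , root t) ∷ ps)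
  extractMin : ∀ {ps} (t : Tree) →
         HeapRun (children t) ps →
         HeapRun (t ∷ []) ps

initialForest : List ℕ → List Tree
initialForest X = map (λ x → node x []) X

HeapAlgWith : List ℕ → List (ℕ × ℕ) → Set
HeapAlgWith X 𝒫 = Σ (List (ℕ × ℕ)) λ ps → HeapRun (initialForest X) ps × SamePairs ps 𝒫

-- Star-path problem on P^{X'} = {⟨i, xᵢ⟩ : i ∈ [n]}.
-- A point is named by its x-coordinate i ∈ [n]; the extra point ⟨0,0⟩
-- is named 0.  Its y-coordinate is yCoord X i (= xᵢ, and 0 for i = 0).

nth : List ℕ → ℕ → ℕ
nth [] _ = 0
nth (x ∷ xs) zero = x
nth (x ∷ xs) (suc i) = nth xs i

yCoord : List ℕ → ℕ → ℕ
yCoord X zero = 0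
yCoord X (suc i) = nth X i

-- a monotone tree on P₀ is given by its parent function on points 1..n
Parent : Set
Parent = ℕ → ℕ

setParent : Parent → ℕ → ℕ → Parent
setParent par a b i = if i ≡ᵇ a then b else par i

starTree : Parent
starTree _ = 0

-- par is path(P): the parent of each point is the point whose
-- y-coordinate is one less (⟨0,0⟩ for the point with y = 1)
IsPath : List ℕ → Parent → Set
IsPath X par = ∀ i → In[n] (length X) i → suc (yCoord X (par i)) ≡ yCoord X i

NeighbourSiblings : List ℕ → Parent → ℕ → ℕ → Set
NeighbourSiblings X par a b =
  In[n] (length X) a × In[n] (length X) b × a < b × par a ≡ par b ×
  (∀ c → a < c → c < b → par c ≢ par a)

starLink : List ℕ → Parent → ℕ → ℕ → Parent
starLink X par a b =
  if yCoord X b <ᵇ yCoord X a then setParent par a b else setParent par b a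

data SPRun (X : List ℕ) : Parent → List (ℕ × ℕ) → Set where
  atPath : ∀ {par} → IsPath X par → SPRun X par []
  linkStep : ∀ {par ps} (a b : ℕ) → NeighbourSiblings X par a b →
             SPRun X (starLink X par a b) ps →
             SPRun X par ((yCoord X a , yCoord X b) ∷ ps)

StarPathAlgWith : List ℕ → List (ℕ × ℕ) → Set
StarPathAlgWith X 𝒫 = Σ (List (ℕ × ℕ)) λ ps → SPRun X starTree ps × SamePairs ps 𝒫

-- View a heap execution as a "forest run" in which extracted roots are
-- not deleted but stay in place; then a link of neighbouring siblings may
-- happen at any depth, in any order, and the run ends when the forest is a
-- single chain.
--  1. Heap runs and forest runs link the same sets of pairs: a heap run is a
--     forest run, and in a forest run deep links commute past top-level ones,
--     so it can be reordered into a heap run (heapRun⇔run).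
--  2. Forests reachable from the singletons of X are heap ordered and every
--     child list occupies consecutive blocks of positions in X; so each key has
--     a unique parent and siblings are ordered by their position in X, which is
--     the x-ordering of the star-path problem (module Invariants).
--  3. Relate a forest to the monotone tree in which the parent of point i is
--     the point carrying the parent key of xᵢ (roots hang below ⟨0,0⟩, key 0).
--     Both kinds of link hang the larger key below the smaller, neighbouring
--     siblings correspond, and the final chain is path(P); so forest runs and
--     star-path runs simulate each other step by step (module Simulation).
-- The theorem is the composition of 1 and 3.

module Submission where

open import Defs
open import Data.Nat using (ℕ; zero; suc; _≤_; _<_; _+_; _<ᵇ_; _≡ᵇ_; s≤s; z≤n)
open import Data.Nat.Properties using (≤-refl; ≤-trans; <⇒≤; <⇒≱; <-irrefl; <-trans; <-asym; <-≤-trans; <-cmp; +-suc; +-monoʳ-<; suc-injective; <ᵇ⇒<; <⇒<ᵇ; ≡ᵇ⇒≡; ≡⇒≡ᵇ)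
open import Data.Bool using (true; false; T; if_then_else_)
open import Data.Unit using (⊤; tt)
open import Data.Empty using (⊥; ⊥-elim)
open import Data.Product using (_×_; _,_; Σ; proj₁; proj₂)
open import Data.Sum using (_⊎_; inj₁; inj₂)
open import Relation.Nullary using (¬_)
open import Relation.Binary using (tri<; tri≈; tri>)
open import Relation.Binary.PropositionalEquality using (_≡_; _≢_; refl; sym; trans; cong; cong₂; subst; subst₂; setoid)
open import Function.Bundles using (_⇔_; mk⇔)
open import Function.Construct.Composition using (_⇔-∘_)
open import Data.List using (List; []; _∷_; _++_; length; [_]; upTo)
open import Data.List.Properties using (++-assoc; ++-identityʳ; length-map; length-upTo)
open import Data.List.Membership.Propositional using (_∈_; _∉_)
open import Data.List.Membership.Propositional.Properties using (∈-++⁺ˡ; ∈-++⁺ʳ; ∈-++⁻; ∈-map⁺; ∈-map⁻; ∈-upTo⁺; ∈-upTo⁻)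
open import Data.List.Relation.Unary.Any using (here; there)
open import Data.List.Relation.Unary.All using (All)
import Data.List.Relation.Unary.All as All
open import Data.List.Relation.Unary.AllPairs using (_∷_)
open import Data.List.Relation.Unary.Unique.Propositional using (Unique)
open import Data.List.Relation.Unary.Unique.Propositional.Properties using (map⁺; upTo⁺)
open import Data.List.Relation.Binary.Permutation.Propositional using (_↭_; ↭-refl; ↭-sym; ↭-trans; ↭-reflexive; prep; swap; ↭⇒↭ₛ)
open import Data.List.Relation.Binary.Permutation.Propositional.Properties using (∈-resp-↭; ↭-length; ++⁺ˡ; ++⁺ʳ; shift)
open import Data.List.Relation.Binary.Permutation.Setoid.Properties (setoid ℕ) using (Unique-resp-↭)

data Step : List Tree → List Tree → ℕ → ℕ → Set where
  linkRoots  : ∀ s t r → Step (s ∷ t ∷ r) (stableLink s t ∷ r) (root s) (root t)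
  linkInside : ∀ {x cs cs' r a b} → Step cs cs' a b → Step (node x cs ∷ r) (node x cs' ∷ r) a b
  linkLater  : ∀ {T F F' a b} → Step F F' a b → Step (T ∷ F) (T ∷ F') a b

data TopStep : List Tree → List Tree → ℕ → ℕ → Set where
  topRoots : ∀ s t r → TopStep (s ∷ t ∷ r) (stableLink s t ∷ r) (root s) (root t)
  topLater : ∀ {T F F' a b} → TopStep F F' a b → TopStep (T ∷ F) (T ∷ F') a b

data DeepStep : List Tree → List Tree → ℕ → ℕ → Set where
  deepInside : ∀ {x cs cs' r a b} → Step cs cs' a b → DeepStep (node x cs ∷ r) (node x cs' ∷ r) a b
  deepLater  : ∀ {T F F' a b} → DeepStep F F' a b → DeepStep (T ∷ F) (T ∷ F') a b

classify : ∀ {F F' a b} → Step F F' a b → TopStep F F' a b ⊎ DeepStep F F' a b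
classify (linkRoots s t r) = inj₁ (topRoots s t r)
classify (linkInside st)   = inj₂ (deepInside st)
classify (linkLater st) with classify st
... | inj₁ tst = inj₁ (topLater tst)
... | inj₂ dst = inj₂ (deepLater dst)

deepToStep : ∀ {F F' a b} → DeepStep F F' a b → Step F F' a b
deepToStep (deepInside st) = linkInside st
deepToStep (deepLater st)  = linkLater (deepToStep st)

stepPrefix : ∀ {F F' a b} (L : List Tree) → Step F F' a b → Step (L ++ F) (L ++ F') a b
stepPrefix []      st = st
stepPrefix (_ ∷ L) st = linkLater (stepPrefix L st)

stepSuffix : ∀ {F F' a b} (M : List Tree) → Step F F' a b → Step (F ++ M) (F' ++ M) a b
stepSuffix M (linkRoots s t r) = linkRoots s t (r ++ M)
stepSuffix M (linkInside st)   = linkInside st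
stepSuffix M (linkLater st)    = linkLater (stepSuffix M st)

-- A deep link followed by a top-level link can be performed in the
-- opposite order: the top-level link only moves whole subtrees.
deepTopCommute : ∀ {F F₁ F₂ a b c d} → DeepStep F F₁ a b → TopStep F₁ F₂ c d →
                 Σ (List Tree) λ G → TopStep F G c d × DeepStep G F₂ a b
deepTopCommute {a = a} {b} (deepInside {x} {cs} {cs'} st) (topRoots _ (node y es) r) =
  _ , topRoots (node x cs) (node y es) r , insideLeft
  where
  insideLeft : DeepStep (stableLink (node x cs) (node y es) ∷ r) (stableLink (node x cs') (node y es) ∷ r) a b
  insideLeft with x <ᵇ y
  ... | true  = deepInside (stepSuffix _ st)
  ... | false = deepInside (linkInside st)
deepTopCommute {a = a} {b} (deepLater (deepInside {y} {es} {es'} st)) (topRoots (node x cs) _ r) =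
  _ , topRoots (node x cs) (node y es) r , insideRight
  where
  insideRight : DeepStep (stableLink (node x cs) (node y es) ∷ r) (stableLink (node x cs) (node y es') ∷ r) a b
  insideRight with x <ᵇ y
  ... | true  = deepInside (stepPrefix cs (linkInside st))
  ... | false = deepInside (linkLater st)
deepTopCommute (deepLater (deepLater dst)) (topRoots s t _) = _ , topRoots s t _ , deepLater dst
deepTopCommute (deepInside st) (topLater tst) = _ , topLater tst , deepInside st
deepTopCommute (deepLater dst) (topLater tst) with deepTopCommute dst tst
... | G , tst' , dst' = _ , topLater tst' , deepLater dst'

-- A forest is finished when it is empty or a single chain: the state
-- reached once every key has been extracted.
data Chain : List Tree → Set where
  empty : Chain []
  chain : ∀ {k cs} → Chain cs → Chain (node k cs ∷ [])

data Run : List Tree → List (ℕ × ℕ) → Set where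
  stop : ∀ {F} → Chain F → Run F []
  step : ∀ {F F' a b ps} → Step F F' a b → Run F' ps → Run F ((a , b) ∷ ps)

data TwoRoots : List Tree → Set where
  twoRoots : ∀ s t r → TwoRoots (s ∷ t ∷ r)

deepKeepsTwoRoots : ∀ {F F' a b} → DeepStep F F' a b → TwoRoots F → TwoRoots F'
deepKeepsTwoRoots (deepInside _)              (twoRoots _ t r) = twoRoots _ t r
deepKeepsTwoRoots (deepLater (deepInside _))  (twoRoots s _ r) = twoRoots s _ r
deepKeepsTwoRoots (deepLater (deepLater _))   (twoRoots s t _) = twoRoots s t _

-- A run of a forest with at least two roots can be reordered to start
-- with a top-level link: deep links before the first top-level one commute past it.
record TopFirst (F : List Tree) (ps : List (ℕ × ℕ)) : Set where
  constructor topFirst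
  field
    {c d}     : ℕ
    {G}       : List Tree
    {qs}      : List (ℕ × ℕ)
    first     : TopStep F G c d
    rest      : Run G qs
    reordered : ((c , d) ∷ qs) ↭ ps

topLinkFirst : ∀ {F ps} → Run F ps → TwoRoots F → TopFirst F ps
topLinkFirst (stop ()) (twoRoots s t r)
topLinkFirst (step st run) tr with classify st
... | inj₁ tst = topFirst tst run ↭-refl
... | inj₂ dst with topLinkFirst run (deepKeepsTwoRoots dst tr)
...   | topFirst tst run' perm with deepTopCommute dst tst
...     | _ , tst' , dst' = topFirst tst' (step (deepToStep dst') run') (↭-trans (swap _ _ ↭-refl) (prep _ perm))

runOfChildren : ∀ {m cs ps} → Run (node m cs ∷ []) ps → Run cs ps
runOfChildren (stop (chain ch))              = stop ch
runOfChildren (step (linkInside st) run)     = step st (runOfChildren run)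
runOfChildren (step (linkLater ()) run)

runUnderRoot : ∀ {m cs ps} → Run cs ps → Run (node m cs ∷ []) ps
runUnderRoot (stop ch)     = stop (chain ch)
runUnderRoot (step st run) = step (linkInside st) (runUnderRoot run)

topStepHeapRun : ∀ {F G c d ps} (L : List Tree) → TopStep F G c d →
                 HeapRun (L ++ G) ps → HeapRun (L ++ F) ((c , d) ∷ ps)
topStepHeapRun L (topRoots s t r) run = link L r s t refl run
topStepHeapRun {ps = ps} L (topLater {T} {F} {F'} tst) run =
  subst (λ z → HeapRun z _) (++-assoc L [ T ] F)
    (topStepHeapRun (L ++ [ T ]) tst (subst (λ z → HeapRun z ps) (sym (++-assoc L [ T ] F')) run))

-- Every forest run can be turned into a heap run linking the same pairs
-- (in another order): while there are several roots, first perform a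
-- top-level link; with one root, extract it.  The fuel k bounds the number of links.
runToHeapRun : (k : ℕ) → ∀ F {ps} → length ps ≤ k → Run F ps →
               Σ (List (ℕ × ℕ)) λ ps' → HeapRun F ps' × (ps' ↭ ps)
runToHeapRun k [] _ (stop _) = [] , finished , ↭-refl
runToHeapRun k (node m cs ∷ []) bound run with runToHeapRun k cs bound (runOfChildren run)
... | ps' , hrun , perm = ps' , extractMin (node m cs) hrun , perm
runToHeapRun zero (s ∷ t ∷ r) _  (stop ())
runToHeapRun zero (s ∷ t ∷ r) () (step _ _)
runToHeapRun (suc k) (s ∷ t ∷ r) bound run with topLinkFirst run (twoRoots s t r)
... | topFirst tst run' perm with runToHeapRun k _ (shorter bound perm) run'
  where
  shorter : ∀ {q qs ps} → length ps ≤ suc k → (q ∷ qs) ↭ ps → length qs ≤ k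
  shorter bound p rewrite sym (↭-length p) with bound
  ... | s≤s le = le
...   | ps' , hrun , perm' = _ , topStepHeapRun [] tst hrun , ↭-trans (prep _ perm') perm

heapRunToRun : ∀ {F ps} → HeapRun F ps → Run F ps
heapRunToRun finished                         = stop empty
heapRunToRun (link L r s t refl run)          = step (stepPrefix L (linkRoots s t r)) (heapRunToRun run)
heapRunToRun (extractMin (node m cs) run)     = runUnderRoot (heapRunToRun run)

umem-↭ : ∀ {a b ps qs} → ps ↭ qs → UMem a b ps → UMem a b qs
umem-↭ p (inj₁ m) = inj₁ (∈-resp-↭ p m)
umem-↭ p (inj₂ m) = inj₂ (∈-resp-↭ p m)

samePairs-↭ : ∀ {ps qs 𝒫} → ps ↭ qs → SamePairs qs 𝒫 → SamePairs ps 𝒫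
samePairs-↭ p same a b = same a b ⇔-∘ mk⇔ (umem-↭ p) (umem-↭ (↭-sym p))

HeapRunWith RunWith : List Tree → List (ℕ × ℕ) → Set
HeapRunWith F 𝒫 = Σ (List (ℕ × ℕ)) λ ps → HeapRun F ps × SamePairs ps 𝒫
RunWith     F 𝒫 = Σ (List (ℕ × ℕ)) λ ps → Run F ps × SamePairs ps 𝒫

heapRun⇔run : ∀ F 𝒫 → HeapRunWith F 𝒫 ⇔ RunWith F 𝒫
heapRun⇔run F 𝒫 = mk⇔ (λ (ps , hrun , same) → ps , heapRunToRun hrun , same) fromRun
  where
  fromRun : RunWith F 𝒫 → HeapRunWith F 𝒫
  fromRun (ps , run , same) with runToHeapRun (length ps) F ≤-refl run
  ... | ps' , hrun , perm = ps' , hrun , samePairs-↭ perm same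

treeKeys : Tree → List ℕ
forestKeys : List Tree → List ℕ
treeKeys (node x cs) = x ∷ forestKeys cs
forestKeys []      = []
forestKeys (t ∷ F) = treeKeys t ++ forestKeys F

forestKeys-++ : ∀ A B → forestKeys (A ++ B) ≡ forestKeys A ++ forestKeys B
forestKeys-++ []      B = refl
forestKeys-++ (t ∷ A) B =
  trans (cong (treeKeys t ++_) (forestKeys-++ A B)) (sym (++-assoc (treeKeys t) (forestKeys A) (forestKeys B)))

∈-forestKeys-++⁻ : ∀ {w} A B → w ∈ forestKeys (A ++ B) → w ∈ forestKeys A ⊎ w ∈ forestKeys B
∈-forestKeys-++⁻ A B m = ∈-++⁻ (forestKeys A) (subst (_ ∈_) (forestKeys-++ A B) m)

∈-forestKeys-[_] : ∀ {w} T → w ∈ forestKeys (T ∷ []) → w ∈ treeKeys T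
∈-forestKeys-[ T ] m with ∈-++⁻ (treeKeys T) m
... | inj₁ m' = m'
... | inj₂ ()

-- ParentIn p F w u : the key w occurs in F and its parent is u, where the
-- roots of F count as children of the (virtual) node p.
data ParentIn : ℕ → List Tree → ℕ → ℕ → Set where
  atRoot  : ∀ {p v cs F} → ParentIn p (node v cs ∷ F) v p
  inChild : ∀ {p v cs F w u} → ParentIn v cs w u → ParentIn p (node v cs ∷ F) w u
  inRest  : ∀ {p T F w u} → ParentIn p F w u → ParentIn p (T ∷ F) w u

parentIn-key : ∀ {p F w u} → ParentIn p F w u → w ∈ forestKeys F
parentIn-key atRoot             = here refl
parentIn-key (inChild h)        = there (∈-++⁺ˡ (parentIn-key h))
parentIn-key (inRest {T = T} h) = ∈-++⁺ʳ (treeKeys T) (parentIn-key h)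

parentIn-parent : ∀ {p F w u} → ParentIn p F w u → u ≡ p ⊎ u ∈ forestKeys F
parentIn-parent atRoot = inj₁ refl
parentIn-parent (inChild h) with parentIn-parent h
... | inj₁ refl = inj₂ (here refl)
... | inj₂ m    = inj₂ (there (∈-++⁺ˡ m))
parentIn-parent (inRest {T = T} h) with parentIn-parent h
... | inj₁ e = inj₁ e
... | inj₂ m = inj₂ (∈-++⁺ʳ (treeKeys T) m)

parentIn-prefix : ∀ {q M w u} L → ParentIn q M w u → ParentIn q (L ++ M) w u
parentIn-prefix []      h = h
parentIn-prefix (_ ∷ L) h = inRest (parentIn-prefix L h)

parentIn-suffix : ∀ {q L w u} M → ParentIn q L w u → ParentIn q (L ++ M) w u
parentIn-suffix M atRoot      = atRoot
parentIn-suffix M (inChild h) = inChild h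
parentIn-suffix M (inRest h)  = inRest (parentIn-suffix M h)

parentIn-split : ∀ {p T F w u} → ParentIn p (T ∷ F) w u → w ∈ treeKeys T ⊎ ParentIn p F w u
parentIn-split atRoot      = inj₁ (here refl)
parentIn-split (inChild h) = inj₁ (there (parentIn-key h))
parentIn-split (inRest h)  = inj₂ h

initialForest-keys : ∀ L → forestKeys (initialForest L) ≡ L
initialForest-keys []      = refl
initialForest-keys (x ∷ L) = cong (x ∷_) (initialForest-keys L)

initialForest-parent : ∀ {p v} L → v ∈ L → ParentIn p (initialForest L) v p
initialForest-parent (x ∷ L) (here refl) = atRoot
initialForest-parent (x ∷ L) (there m)   = inRest (initialForest-parent L m)

loser winner : ℕ → ℕ → ℕ
loser  a b = if a <ᵇ b then b else a
winner a b = if a <ᵇ b then a else b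

loserBelowWinner : ∀ {F F' a b} → Step F F' a b → ∀ p → ParentIn p F' (loser a b) (winner a b)
loserBelowWinner (linkRoots (node x cs) (node y es) r) p with x <ᵇ y
... | true  = inChild (parentIn-prefix cs atRoot)
... | false = inChild atRoot
loserBelowWinner (linkInside {x} st) p = inChild (loserBelowWinner st x)
loserBelowWinner (linkLater st)      p = inRest (loserBelowWinner st p)

othersKeepParent : ∀ {F F' a b} → Step F F' a b → ∀ {p w u} → ParentIn p F w u → w ≢ loser a b → ParentIn p F' w u
othersKeepParent (linkRoots (node x cs) (node y es) r) h ne with x <ᵇ y | h
... | true  | atRoot                   = atRoot
... | true  | inChild h'               = inChild (parentIn-suffix _ h')
... | true  | inRest atRoot            = ⊥-elim (ne refl)
... | true  | inRest (inChild h')      = inChild (parentIn-prefix cs (inChild h'))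
... | true  | inRest (inRest h')       = inRest h'
... | false | atRoot                   = ⊥-elim (ne refl)
... | false | inChild h'               = inChild (inChild h')
... | false | inRest atRoot            = atRoot
... | false | inRest (inChild h')      = inChild (inRest h')
... | false | inRest (inRest h')       = inRest h'
othersKeepParent (linkInside st) atRoot      ne = atRoot
othersKeepParent (linkInside st) (inChild h) ne = inChild (othersKeepParent st h ne)
othersKeepParent (linkInside st) (inRest h)  ne = inRest h
othersKeepParent (linkLater st)  atRoot      ne = atRoot
othersKeepParent (linkLater st)  (inChild h) ne = inChild h
othersKeepParent (linkLater st)  (inRest h)  ne = inRest (othersKeepParent st h ne)

linkedAreSiblings : ∀ {F F' a b} → Step F F' a b → ∀ p → Σ ℕ λ u → ParentIn p F a u × ParentIn p F b u
linkedAreSiblings (linkRoots (node _ _) (node _ _) _) p = p , atRoot , inRest atRoot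
linkedAreSiblings (linkInside {x} st) p with linkedAreSiblings st x
... | u , ha , hb = u , inChild ha , inChild hb
linkedAreSiblings (linkLater st) p with linkedAreSiblings st p
... | u , ha , hb = u , inRest ha , inRest hb

stableLinkKeys : ∀ s t → treeKeys (stableLink s t) ↭ treeKeys s ++ treeKeys t
stableLinkKeys (node x cs) (node y es) with x <ᵇ y
... | true  = prep x (↭-reflexive (trans (forestKeys-++ cs (node y es ∷ [])) (cong (forestKeys cs ++_) (++-identityʳ _))))
... | false = ↭-sym (shift y (x ∷ forestKeys cs) (forestKeys es))

stepKeys : ∀ {F F' a b} → Step F F' a b → forestKeys F' ↭ forestKeys F
stepKeys (linkRoots s t r) =
  ↭-trans (++⁺ʳ (forestKeys r) (stableLinkKeys s t)) (↭-reflexive (++-assoc (treeKeys s) (treeKeys t) (forestKeys r)))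
stepKeys (linkInside {x} {r = r} st) = prep x (++⁺ʳ (forestKeys r) (stepKeys st))
stepKeys (linkLater {T} st)          = ++⁺ˡ (treeKeys T) (stepKeys st)

keyBeforeStep : ∀ {F F' a b w} → Step F F' a b → w ∈ forestKeys F' → w ∈ forestKeys F
keyBeforeStep st = ∈-resp-↭ (stepKeys st)

<ᵇ-true : ∀ {m n} → (m <ᵇ n) ≡ true → m < n
<ᵇ-true {m} {n} e = <ᵇ⇒< m n (subst T (sym e) tt)

<ᵇ-false : ∀ {m n} → (m <ᵇ n) ≡ false → ¬ (m < n)
<ᵇ-false e lt = subst T e (<⇒<ᵇ lt)

nth-∈ : ∀ (L : List ℕ) j → j < length L → nth L j ∈ L
nth-∈ (x ∷ L) zero    _         = here refl
nth-∈ (x ∷ L) (suc j) (s≤s lt) = there (nth-∈ L j lt)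

∈-nth : ∀ {v} (L : List ℕ) → v ∈ L → Σ ℕ λ j → j < length L × nth L j ≡ v
∈-nth (x ∷ L) (here refl) = zero , s≤s z≤n , refl
∈-nth (x ∷ L) (there m) with ∈-nth L m
... | j , lt , e = suc j , s≤s lt , e

-- Invariants of forests reachable from the initial forest of X, where
-- pos v is the position of the key v in X.
module Invariants (pos : ℕ → ℕ) where

  SortedTree : Tree → Set
  Sorted     : List Tree → Set
  SortedTree (node x cs) = Sorted cs
  Sorted []      = ⊤
  Sorted (T ∷ F) = SortedTree T × Sorted F × (∀ u w → u ∈ treeKeys T → w ∈ forestKeys F → pos u < pos w)

  HeapOrderedTree : Tree → Set
  HeapOrdered     : List Tree → Set
  HeapOrderedTree (node x cs) = (∀ w → w ∈ forestKeys cs → x < w) × HeapOrdered cs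
  HeapOrdered []      = ⊤
  HeapOrdered (T ∷ F) = HeapOrderedTree T × HeapOrdered F

  pos-irrefl : ∀ {u} → pos u < pos u → ⊥
  pos-irrefl = <-irrefl refl

  leftTreeDisjoint : ∀ {T F u} → Sorted (T ∷ F) → u ∈ treeKeys T → u ∈ forestKeys F → ⊥
  leftTreeDisjoint (_ , _ , before) uT uF = pos-irrefl (before _ _ uT uF)

  sorted-++ : ∀ A B → Sorted A → Sorted B → (∀ u w → u ∈ forestKeys A → w ∈ forestKeys B → pos u < pos w) → Sorted (A ++ B)
  sorted-++ []      B _ sB _ = sB
  sorted-++ (T ∷ A) B (sT , sA , beforeA) sB before =
    sT , sorted-++ A B sA sB (λ u w um wm → before u w (∈-++⁺ʳ (treeKeys T) um) wm) , beforeAB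
    where
    beforeAB : ∀ u w → u ∈ treeKeys T → w ∈ forestKeys (A ++ B) → pos u < pos w
    beforeAB u w um wm with ∈-forestKeys-++⁻ A B wm
    ... | inj₁ m = beforeA u w um m
    ... | inj₂ m = before u w (∈-++⁺ˡ um) m

  heapOrdered-++ : ∀ A B → HeapOrdered A → HeapOrdered B → HeapOrdered (A ++ B)
  heapOrdered-++ []      B _          hB = hB
  heapOrdered-++ (T ∷ A) B (hT , hA) hB = hT , heapOrdered-++ A B hA hB

  stableLink-sorted : ∀ s t → SortedTree s → SortedTree t →
    (∀ u w → u ∈ treeKeys s → w ∈ treeKeys t → pos u < pos w) → SortedTree (stableLink s t)
  stableLink-sorted (node x cs) (node y es) ss st before with x <ᵇ y
  ... | true  = sorted-++ cs (node y es ∷ []) ss (st , tt , λ _ _ _ ())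
                  (λ u w um wm → before u w (there um) (∈-forestKeys-[ node y es ] wm))
  ... | false = ss , st , λ u w um wm → before u w um (there wm)

  stableLink-heapOrdered : ∀ s t → HeapOrderedTree s → HeapOrderedTree t → root s ≢ root t →
    HeapOrderedTree (stableLink s t)
  stableLink-heapOrdered (node x cs) (node y es) (hx , hcs) (hy , hes) x≢y with x <ᵇ y in x<ᵇy
  ... | true  = aboveAll , heapOrdered-++ cs (node y es ∷ []) hcs ((hy , hes) , tt)
    where
    aboveAll : ∀ w → w ∈ forestKeys (cs ++ node y es ∷ []) → x < w
    aboveAll w m with ∈-forestKeys-++⁻ cs (node y es ∷ []) m
    ... | inj₁ m' = hx w m'
    ... | inj₂ m' with ∈-forestKeys-[ node y es ] m'
    ...   | here refl = <ᵇ-true x<ᵇy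
    ...   | there m'' = <-trans (<ᵇ-true x<ᵇy) (hy w m'')
  ... | false = aboveAll , (hx , hcs) , hes
    where
    y<x : y < x
    y<x with <-cmp x y
    ... | tri< x<y _ _ = ⊥-elim (<ᵇ-false x<ᵇy x<y)
    ... | tri≈ _ x≡y _ = ⊥-elim (x≢y x≡y)
    ... | tri> _ _ y<x = y<x
    aboveAll : ∀ w → w ∈ forestKeys (node x cs ∷ es) → y < w
    aboveAll w (here refl) = y<x
    aboveAll w (there m) with ∈-++⁻ (forestKeys cs) m
    ... | inj₁ m' = <-trans y<x (hx w m')
    ... | inj₂ m' = hy w m'

  stepPreserves : ∀ {F F' a b} → Step F F' a b → Sorted F → HeapOrdered F → Sorted F' × HeapOrdered F'
  stepPreserves (linkRoots (node x cs) (node y es) r) (ss , (st , sr , tBefore) , sBefore) (hs , ht , hr) =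
    (stableLink-sorted (node x cs) (node y es) ss st (λ u w um wm → sBefore u w um (∈-++⁺ˡ wm)) , sr , linkedBefore) ,
    (stableLink-heapOrdered (node x cs) (node y es) hs ht x≢y , hr)
    where
    x≢y : x ≢ y
    x≢y refl = pos-irrefl (sBefore x x (here refl) (here refl))
    linkedBefore : ∀ u w → u ∈ treeKeys (stableLink (node x cs) (node y es)) → w ∈ forestKeys r → pos u < pos w
    linkedBefore u w um wm with ∈-++⁻ (treeKeys (node x cs)) (∈-resp-↭ (stableLinkKeys (node x cs) (node y es)) um)
    ... | inj₁ m = sBefore u w m (∈-++⁺ʳ (treeKeys (node y es)) wm)
    ... | inj₂ m = tBefore u w m wm
  stepPreserves (linkInside {x} {cs} {cs'} st) (scs , sr , before) ((hx , hcs) , hr) with stepPreserves st scs hcs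
  ... | scs' , hcs' = (scs' , sr , λ u w um wm → before u w (keyBefore um) wm) , ((λ w m → hx w (keyBeforeStep st m)) , hcs') , hr
    where
    keyBefore : ∀ {u} → u ∈ treeKeys (node x cs') → u ∈ treeKeys (node x cs)
    keyBefore (here e)  = here e
    keyBefore (there m) = there (keyBeforeStep st m)
  stepPreserves (linkLater st) (sT , sF , before) (hT , hF) with stepPreserves st sF hF
  ... | sF' , hF' = (sT , sF' , λ u w um wm → before u w um (keyBeforeStep st wm)) , (hT , hF')

  linkedInOrder : ∀ {F F' a b} → Step F F' a b → Sorted F → pos a < pos b
  linkedInOrder (linkRoots (node x _) (node y _) _) (_ , _ , before) = before x y (here refl) (here refl)
  linkedInOrder (linkInside st) (scs , _ , _) = linkedInOrder st scs
  linkedInOrder (linkLater st)  (_ , sF , _)  = linkedInOrder st sF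

  linkedDistinct : ∀ {F F' a b} → Step F F' a b → Sorted F → a ≢ b
  linkedDistinct st sorted refl = pos-irrefl (linkedInOrder st sorted)

  initialForest-heapOrdered : ∀ L → HeapOrdered (initialForest L)
  initialForest-heapOrdered []      = tt
  initialForest-heapOrdered (x ∷ L) = ((λ _ ()) , tt) , initialForest-heapOrdered L

  initialForest-sorted : ∀ L k → (∀ j → j < length L → pos (nth L j) ≡ k + j) → Sorted (initialForest L)
  initialForest-sorted []      k _       = tt
  initialForest-sorted (x ∷ L) k posAt = tt , initialForest-sorted L (suc k) posAtTail , xBefore
    where
    posAtTail : ∀ j → j < length L → pos (nth L j) ≡ suc k + j
    posAtTail j lt = trans (posAt (suc j) (s≤s lt)) (+-suc k j)
    xBefore : ∀ u w → u ∈ treeKeys (node x []) → w ∈ forestKeys (initialForest L) → pos u < pos w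
    xBefore u w (here refl) wm with ∈-nth L (subst (w ∈_) (initialForest-keys L) wm)
    ... | j , lt , refl rewrite posAt zero (s≤s z≤n) | posAt (suc j) (s≤s lt) = +-monoʳ-< k (s≤s z≤n)

  rootNotBelow : ∀ {x cs} → HeapOrderedTree (node x cs) → x ∉ forestKeys cs
  rootNotBelow (above , _) m = <-irrefl refl (above _ m)

  parentInTree : ∀ {v cs w u} → ParentIn v cs w u → u ∈ treeKeys (node v cs)
  parentInTree h with parentIn-parent h
  ... | inj₁ refl = here refl
  ... | inj₂ m    = there m

  parentUnique : ∀ {p F w u u'} → Sorted F → HeapOrdered F → ParentIn p F w u → ParentIn p F w u' → u ≡ u'
  parentUnique _ _  atRoot      atRoot       = refl
  parentUnique _ (hT , _) atRoot (inChild h) = ⊥-elim (rootNotBelow hT (parentIn-key h))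
  parentUnique s _  atRoot      (inRest h)   = ⊥-elim (leftTreeDisjoint s (here refl) (parentIn-key h))
  parentUnique _ (hT , _) (inChild h) atRoot = ⊥-elim (rootNotBelow hT (parentIn-key h))
  parentUnique (scs , _ , _) ((_ , hcs) , _) (inChild h) (inChild h') = parentUnique scs hcs h h'
  parentUnique s _  (inChild h) (inRest h')  = ⊥-elim (leftTreeDisjoint s (there (parentIn-key h)) (parentIn-key h'))
  parentUnique s _  (inRest h)  atRoot       = ⊥-elim (leftTreeDisjoint s (here refl) (parentIn-key h))
  parentUnique s _  (inRest h)  (inChild h') = ⊥-elim (leftTreeDisjoint s (there (parentIn-key h')) (parentIn-key h))
  parentUnique (_ , sF , _) (_ , hF) (inRest h) (inRest h') = parentUnique sF hF h h'

  linkedAreNeighbours : ∀ {F F' a b p u w} → Step F F' a b → Sorted F → HeapOrdered F → p ∉ forestKeys F →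
    ParentIn p F a u → ParentIn p F w u → pos a < pos w → pos w < pos b → ⊥
  linkedAreNeighbours (linkRoots (node x cs) (node y es) r) s@(_ , (_ , _ , yBefore) , _) ho p∉ ha hw a<w w<b
    with parentUnique s ho ha atRoot
  ... | refl with hw
  ...   | atRoot                = pos-irrefl a<w
  ...   | inChild h             = p∉ (∈-++⁺ˡ (parentInTree h))
  ...   | inRest atRoot         = pos-irrefl w<b
  ...   | inRest (inChild h)    = p∉ (∈-++⁺ʳ (treeKeys (node x cs)) (∈-++⁺ˡ (parentInTree h)))
  ...   | inRest (inRest h)     = <-asym w<b (yBefore y _ (here refl) (parentIn-key h))
  linkedAreNeighbours (linkInside {x} st) s@(scs , _ , before) ho@(hT , hr) p∉ ha hw a<w w<b
    with linkedAreSiblings st x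
  ... | _ , ha₀ , hb₀ with ha
  ...   | atRoot     = rootNotBelow hT (parentIn-key ha₀)
  ...   | inRest h   = leftTreeDisjoint s (there (parentIn-key ha₀)) (parentIn-key h)
  ...   | inChild ha' with hw
  ...     | atRoot      = p∉ (∈-++⁺ˡ (parentInTree ha'))
  ...     | inChild hw' = linkedAreNeighbours st scs (proj₂ hT) (rootNotBelow hT) ha' hw' a<w w<b
  ...     | inRest hw'  = <-asym w<b (before _ _ (there (parentIn-key hb₀)) (parentIn-key hw'))
  linkedAreNeighbours {p = p} (linkLater {T} st) s@(_ , sF , before) (_ , hF) p∉ ha hw a<w w<b
    with parentIn-key (proj₁ (proj₂ (linkedAreSiblings st p))) | parentIn-split ha | parentIn-split hw
  ... | aF | inj₁ aT  | _         = leftTreeDisjoint s aT aF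
  ... | aF | inj₂ _   | inj₁ wT   = <-asym a<w (before _ _ wT aF)
  ... | _  | inj₂ ha' | inj₂ hw'  = linkedAreNeighbours st sF hF (λ m → p∉ (∈-++⁺ʳ (treeKeys T) m)) ha' hw' a<w w<b

  neighboursLinkable : ∀ {p F a b u} → Sorted F → HeapOrdered F → p ∉ forestKeys F →
    ParentIn p F a u → ParentIn p F b u → pos a < pos b →
    (∀ w → ParentIn p F w u → pos a < pos w → pos w < pos b → ⊥) → Σ (List Tree) λ F' → Step F F' a b
  neighboursLinkable _ _ _ atRoot atRoot a<b _ = ⊥-elim (pos-irrefl a<b)
  neighboursLinkable _ _ p∉ atRoot (inChild hb) _ _ = ⊥-elim (p∉ (∈-++⁺ˡ (parentInTree hb)))
  neighboursLinkable {F = node x cs ∷ node v es ∷ r} _ _ _ atRoot (inRest atRoot) _ _ =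
    _ , linkRoots (node x cs) (node v es) r
  neighboursLinkable {F = node x cs ∷ _} _ _ p∉ atRoot (inRest (inChild hb)) _ _ =
    ⊥-elim (p∉ (∈-++⁺ʳ (treeKeys (node x cs)) (∈-++⁺ˡ (parentInTree hb))))
  neighboursLinkable {F = node x cs ∷ node v es ∷ r} (_ , (_ , _ , vBefore) , before) _ _ atRoot (inRest (inRest hb)) _ between =
    ⊥-elim (between v (inRest atRoot) (before x v (here refl) (here refl)) (vBefore v _ (here refl) (parentIn-key hb)))
  neighboursLinkable _ _ p∉ (inChild ha) atRoot _ _ = ⊥-elim (p∉ (∈-++⁺ˡ (parentInTree ha)))
  neighboursLinkable (scs , _ , _) (hT , _) _ (inChild ha) (inChild hb) a<b between
    with neighboursLinkable scs (proj₂ hT) (rootNotBelow hT) ha hb a<b (λ w h → between w (inChild h))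
  ... | _ , st = _ , linkInside st
  neighboursLinkable s _ p∉ (inChild ha) (inRest hb) _ _ with parentIn-parent hb
  ... | inj₁ refl = ⊥-elim (p∉ (∈-++⁺ˡ (parentInTree ha)))
  ... | inj₂ m    = ⊥-elim (leftTreeDisjoint s (parentInTree ha) m)
  neighboursLinkable (_ , _ , before) _ _ (inRest ha) atRoot a<b _ =
    ⊥-elim (<-asym a<b (before _ _ (here refl) (parentIn-key ha)))
  neighboursLinkable (_ , _ , before) _ _ (inRest ha) (inChild hb) a<b _ =
    ⊥-elim (<-asym a<b (before _ _ (there (parentIn-key hb)) (parentIn-key ha)))
  neighboursLinkable {F = T ∷ _} (_ , sF , _) (_ , hF) p∉ (inRest ha) (inRest hb) a<b between
    with neighboursLinkable sF hF (λ m → p∉ (∈-++⁺ʳ (treeKeys T) m)) ha hb a<b (λ w h → between w (inRest h))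
  ... | _ , st = _ , linkLater st

  pathIsChain : ∀ {p F} → Sorted F → (∀ w u → ParentIn p F w u → w ≡ suc u) → Chain F
  pathIsChain {F = []} _ _ = empty
  pathIsChain {F = node x cs ∷ []} (scs , _ , _) succOfParent = chain (pathIsChain scs (λ w u h → succOfParent w u (inChild h)))
  pathIsChain {p} {F = node x cs ∷ node v es ∷ r} (_ , _ , before) succOfParent =
    ⊥-elim (pos-irrefl (subst (λ z → pos x < pos z) v≡x (before x v (here refl) (here refl))))
    where
    v≡x : v ≡ x
    v≡x = trans (succOfParent v p (inRest atRoot)) (sym (succOfParent x p atRoot))

  chainIsPath : ∀ (N : ℕ) {p F w u} → Chain F → HeapOrdered F →
    (∀ v → v ∈ forestKeys F → suc p ≤ v × v ≤ N) → (∀ v → suc p ≤ v → v ≤ N → v ∈ forestKeys F) →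
    ParentIn p F w u → w ≡ suc u
  chainIsPath N {p} {node k cs ∷ []} (chain ch) ((above , hcs) , _) inRange complete = go
    where
    k≡1+p : k ≡ suc p
    k≡1+p with complete (suc p) ≤-refl (≤-trans (proj₁ (inRange k (here refl))) (proj₂ (inRange k (here refl))))
    ... | here e = sym e
    ... | there m with ∈-++⁻ (forestKeys cs) m
    ...   | inj₁ m' = ⊥-elim (<⇒≱ (above _ m') (proj₁ (inRange k (here refl))))
    ...   | inj₂ ()
    inRangeBelow : ∀ v → v ∈ forestKeys cs → suc k ≤ v × v ≤ N
    inRangeBelow v m = above v m , proj₂ (inRange v (there (∈-++⁺ˡ m)))
    completeBelow : ∀ v → suc k ≤ v → v ≤ N → v ∈ forestKeys cs
    completeBelow v k<v v≤N with complete v (subst (_≤ v) k≡1+p (<⇒≤ k<v)) v≤N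
    ... | here refl = ⊥-elim (<-irrefl refl k<v)
    ... | there m with ∈-++⁻ (forestKeys cs) m
    ...   | inj₁ m' = m'
    ...   | inj₂ ()
    go : ∀ {w u} → ParentIn p (node k cs ∷ []) w u → w ≡ suc u
    go atRoot      = k≡1+p
    go (inChild h) = chainIsPath N ch hcs inRangeBelow completeBelow h
    go (inRest ())

-- posIn L v : the 1-based position of v in L (0 if v does not occur).
posIn : List ℕ → ℕ → ℕ
posIn []       v = 0
posIn (x ∷ xs) v = if v ≡ᵇ x then 1 else suc (posIn xs v)

posIn-nth : ∀ (L : List ℕ) → Unique L → ∀ j → j < length L → posIn L (nth L j) ≡ suc j
posIn-nth (x ∷ L) _ zero _ with x ≡ᵇ x in e
... | true  = refl
... | false = ⊥-elim (subst T e (≡⇒≡ᵇ x x refl))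
posIn-nth (x ∷ L) (x∉ ∷ u) (suc j) (s≤s lt) with nth L j ≡ᵇ x in e
... | true  = ⊥-elim (All.lookup x∉ (nth-∈ L j lt) (sym (≡ᵇ⇒≡ _ _ (subst T (sym e) tt))))
... | false = cong suc (posIn-nth L u j lt)

nth-posIn : ∀ {v} (L : List ℕ) → v ∈ L → Σ ℕ λ j → posIn L v ≡ suc j × j < length L × nth L j ≡ v
nth-posIn {v} (x ∷ L) m with v ≡ᵇ x in e
... | true = zero , refl , s≤s z≤n , sym (≡ᵇ⇒≡ v x (subst T (sym e) tt))
nth-posIn {v} (x ∷ L) (here refl) | false = ⊥-elim (subst T e (≡⇒≡ᵇ v v refl))
nth-posIn {v} (x ∷ L) (there m)   | false with nth-posIn L m
... | j , p , lt , q = suc j , cong suc p , s≤s lt , q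

-- For distinct keys, the stable link (testing left < right) and the
-- star-path link (testing right < left) choose the same winner.
if-flip : ∀ {C : Set} (c d : C) m n → m ≢ n → (if n <ᵇ m then c else d) ≡ (if m <ᵇ n then d else c)
if-flip c d m n m≢n with m <ᵇ n in m<n | n <ᵇ m in n<m
... | true  | true  = ⊥-elim (<-asym (<ᵇ-true {m} {n} m<n) (<ᵇ-true {n} {m} n<m))
... | true  | false = refl
... | false | true  = refl
... | false | false with <-cmp m n
...   | tri< lt _ _ = ⊥-elim (<ᵇ-false {m} {n} m<n lt)
...   | tri≈ _ eq _ = ⊥-elim (m≢n eq)
...   | tri> _ _ gt = ⊥-elim (<ᵇ-false {n} {m} n<m gt)

-- Point i ∈ [N] of P^{X'} carries the key yCoord X i = xᵢ,
-- and the key v sits at the point pos v.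
module Simulation (X : List ℕ) (uniqueX : Unique X)
  (inRange : ∀ v → v ∈ X → In[n] (length X) v) (complete : ∀ v → In[n] (length X) v → v ∈ X) where

  N : ℕ
  N = length X

  pos : ℕ → ℕ
  pos = posIn X

  open Invariants pos

  y : ℕ → ℕ
  y = yCoord X

  y-∈ : ∀ i → In[n] N i → y i ∈ X
  y-∈ (suc i) (_ , le) = nth-∈ X i le

  pos-y : ∀ i → In[n] N i → pos (y i) ≡ i
  pos-y (suc i) (_ , le) = posIn-nth X uniqueX i le

  y-pos : ∀ v → v ∈ X → In[n] N (pos v) × y (pos v) ≡ v
  y-pos v m with nth-posIn X m
  ... | j , p , lt , q rewrite p = (s≤s z≤n , lt) , q

  -- Keys of distinct points of P₀ differ (the point 0 has key 0 ∉ X).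
  y-injective : ∀ i j → i ≤ N → j ≤ N → y i ≡ y j → i ≡ j
  y-injective zero    zero    _ _ _ = refl
  y-injective zero    (suc j) _ l e with inRange _ (nth-∈ X j l)
  ... | lo , _ rewrite sym e with lo
  ... | ()
  y-injective (suc i) zero    l _ e with inRange _ (nth-∈ X i l)
  ... | lo , _ rewrite e with lo
  ... | ()
  y-injective (suc i) (suc j) li lj e =
    trans (sym (pos-y (suc i) (s≤s z≤n , li))) (trans (cong pos e) (pos-y (suc j) (s≤s z≤n , lj)))

  Reachable : List Tree → Set
  Reachable F = Sorted F × HeapOrdered F × (∀ w → w ∈ forestKeys F → w ∈ X)

  reachableStep : ∀ {F F' a b} → Step F F' a b → Reachable F → Reachable F'
  reachableStep st (sorted , heap , keys) with stepPreserves st sorted heap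
  ... | sorted' , heap' = sorted' , heap' , λ w m → keys w (keyBeforeStep st m)

  zero∉ : ∀ {F} → Reachable F → 0 ∉ forestKeys F
  zero∉ (_ , _ , keys) m with inRange 0 (keys 0 m)
  ... | () , _

  Corresponds : List Tree → Parent → Set
  Corresponds F par = ∀ i → In[n] N i → par i ≤ N × ParentIn 0 F (y i) (y (par i))

  linkIsNeighbourSiblings : ∀ {F F' par i j} → Step F F' (y i) (y j) → Reachable F → Corresponds F par →
    In[n] N i → In[n] N j → NeighbourSiblings X par i j
  linkIsNeighbourSiblings {F} {par = par} {i} {j} st reach@(sorted , heap , _) corr iN jN =
    iN , jN , i<j , sameParent , noneBetween
    where
    parentOf : ∀ {v w u} → ParentIn 0 F v w → ParentIn 0 F v u → w ≡ u
    parentOf = parentUnique sorted heap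
    sibs = linkedAreSiblings st 0
    i<j : i < j
    i<j = subst₂ _<_ (pos-y i iN) (pos-y j jN) (linkedInOrder st sorted)
    sameParent : par i ≡ par j
    sameParent = y-injective _ _ (proj₁ (corr i iN)) (proj₁ (corr j jN))
      (trans (parentOf (proj₂ (corr i iN)) (proj₁ (proj₂ sibs))) (parentOf (proj₂ (proj₂ sibs)) (proj₂ (corr j jN))))
    noneBetween : ∀ c → i < c → c < j → par c ≢ par i
    noneBetween c i<c c<j pc≡pi =
      linkedAreNeighbours st sorted heap (zero∉ reach) (proj₂ (corr i iN)) hc
        (subst₂ _<_ (sym (pos-y i iN)) (sym (pos-y c cN)) i<c) (subst₂ _<_ (sym (pos-y c cN)) (sym (pos-y j jN)) c<j)
      where
      cN : In[n] N c
      cN = ≤-trans (proj₁ iN) (<⇒≤ i<c) , <⇒≤ (<-≤-trans c<j (proj₂ jN))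
      hc : ParentIn 0 F (y c) (y (par i))
      hc = subst (λ q → ParentIn 0 F (y c) (y q)) pc≡pi (proj₂ (corr c cN))

  neighbourSiblingsLink : ∀ {F par i j} → NeighbourSiblings X par i j → Reachable F → Corresponds F par →
    Σ (List Tree) λ F' → Step F F' (y i) (y j)
  neighbourSiblingsLink {F} {par} {i} {j} (iN , jN , i<j , pi≡pj , noneBetween) reach@(sorted , heap , keys) corr =
    neighboursLinkable sorted heap (zero∉ reach) (proj₂ (corr i iN)) hj
      (subst₂ _<_ (sym (pos-y i iN)) (sym (pos-y j jN)) i<j) noSiblingBetween
    where
    hj : ParentIn 0 F (y j) (y (par i))
    hj = subst (λ q → ParentIn 0 F (y j) (y q)) (sym pi≡pj) (proj₂ (corr j jN))
    noSiblingBetween : ∀ w → ParentIn 0 F w (y (par i)) → pos (y i) < pos w → pos w < pos (y j) → ⊥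
    noSiblingBetween w h l1 l2 with y-pos w (keys w (parentIn-key h))
    ... | cN , yc≡w = noneBetween (pos w) (subst (_< pos w) (pos-y i iN) l1) (subst (pos w <_) (pos-y j jN) l2) pc≡pi
      where
      pc≡pi : par (pos w) ≡ par i
      pc≡pi = y-injective _ _ (proj₁ (corr (pos w) cN)) (proj₁ (corr i iN))
        (parentUnique sorted heap (subst (λ z → ParentIn 0 F z (y (par (pos w)))) yc≡w (proj₂ (corr (pos w) cN))) h)

  correspondsSetParent : ∀ {F F' par l w} → Corresponds F par → In[n] N l → w ≤ N →
    (∀ {v u} → ParentIn 0 F v u → v ≢ y l → ParentIn 0 F' v u) → ParentIn 0 F' (y l) (y w) →
    Corresponds F' (setParent par l w)
  correspondsSetParent {F' = F'} {par} {l} {w} corr lN w≤N keep moved i iN with i ≡ᵇ l in e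
  ... | true  = subst (λ k → w ≤ N × ParentIn 0 F' (y k) (y w)) (sym (≡ᵇ⇒≡ i l (subst T (sym e) tt))) (w≤N , moved)
  ... | false = proj₁ (corr i iN) , keep (proj₂ (corr i iN)) i≢l
    where
    i≢l : y i ≢ y l
    i≢l yi≡yl = subst T e (≡⇒≡ᵇ i l (y-injective i l (proj₂ iN) (proj₂ lN) yi≡yl))

  correspondsAfterLink : ∀ {F F' par i j} → Step F F' (y i) (y j) → Reachable F → Corresponds F par →
    In[n] N i → In[n] N j → Corresponds F' (starLink X par i j)
  correspondsAfterLink {par = par} {i} {j} st (sorted , _) corr iN jN
    rewrite if-flip (setParent par i j) (setParent par j i) (y i) (y j) (linkedDistinct st sorted)
    with y i <ᵇ y j | loserBelowWinner st 0 | othersKeepParent st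
  ... | true  | moved | keep = correspondsSetParent corr jN (proj₂ iN) keep moved
  ... | false | moved | keep = correspondsSetParent corr iN (proj₂ jN) keep moved

  runToStarPath : ∀ {F ps par} → Run F ps → Reachable F → Corresponds F par → SPRun X par ps
  runToStarPath {F} {par = par} (stop ch) (_ , heap , keys) corr = atPath isPath
    where
    allKeys : ∀ v → 1 ≤ v → v ≤ N → v ∈ forestKeys F
    allKeys v l1 l2 with y-pos v (complete v (l1 , l2))
    ... | vN , yv = subst (_∈ forestKeys F) yv (parentIn-key (proj₂ (corr (pos v) vN)))
    isPath : IsPath X par
    isPath i iN = sym (chainIsPath N ch heap (λ v m → inRange v (keys v m)) allKeys (proj₂ (corr i iN)))
  runToStarPath {F} {par = par} (step {F' = F'} {a = a} {b} {ps} st run) reach@(_ , _ , keys) corr =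
    subst (λ q → SPRun X par (q ∷ ps)) (cong₂ _,_ ya yb)
      (linkStep (pos a) (pos b) (linkIsNeighbourSiblings st' reach corr aN bN)
        (runToStarPath run (reachableStep st reach) (correspondsAfterLink st' reach corr aN bN)))
    where
    sibs = linkedAreSiblings st 0
    aPoint = y-pos a (keys a (parentIn-key (proj₁ (proj₂ sibs))))
    bPoint = y-pos b (keys b (parentIn-key (proj₂ (proj₂ sibs))))
    aN = proj₁ aPoint
    bN = proj₁ bPoint
    ya = proj₂ aPoint
    yb = proj₂ bPoint
    st' : Step F F' (y (pos a)) (y (pos b))
    st' = subst₂ (Step F F') (sym ya) (sym yb) st

  starPathToRun : ∀ {F ps par} → SPRun X par ps → Reachable F → Corresponds F par → Run F ps
  starPathToRun {F} {par = par} (atPath isPath) (sorted , heap , keys) corr = stop (pathIsChain sorted succOfParent)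
    where
    succOfParent : ∀ w u → ParentIn 0 F w u → w ≡ suc u
    succOfParent w u h with y-pos w (keys w (parentIn-key h))
    ... | wN , yw = trans (sym yw) (trans (sym (isPath (pos w) wN)) (cong suc parentIsU))
      where
      parentIsU : y (par (pos w)) ≡ u
      parentIsU = parentUnique sorted heap (subst (λ z → ParentIn 0 F z (y (par (pos w)))) yw (proj₂ (corr (pos w) wN))) h
  starPathToRun (linkStep i j ns@(iN , jN , _) run) reach corr with neighbourSiblingsLink ns reach corr
  ... | _ , st = step st (starPathToRun run (reachableStep st reach) (correspondsAfterLink st reach corr iN jN))

  initialReachable : Reachable (initialForest X)
  initialReachable =
    initialForest-sorted X 1 (posIn-nth X uniqueX) , initialForest-heapOrdered X ,
    λ w m → subst (w ∈_) (initialForest-keys X) m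

  initialCorresponds : Corresponds (initialForest X) starTree
  initialCorresponds i iN = z≤n , initialForest-parent X (y-∈ i iN)

  run⇔starPath : ∀ 𝒫 → RunWith (initialForest X) 𝒫 ⇔ StarPathAlgWith X 𝒫
  run⇔starPath 𝒫 =
    mk⇔ (λ (ps , run , same) → ps , runToStarPath run initialReachable initialCorresponds , same)
        (λ (ps , sp , same) → ps , starPathToRun sp initialReachable initialCorresponds , same)

module Permutation {n : ℕ} {X : List ℕ} (perm : IsPermOf n X) where

  length≡n : length X ≡ n
  length≡n = trans (↭-length perm) (trans (length-map suc (upTo n)) (length-upTo n))

  unique : Unique X
  unique = Unique-resp-↭ (↭⇒↭ₛ (↭-sym perm)) (map⁺ suc-injective (upTo⁺ n))

  inRange : ∀ v → v ∈ X → In[n] (length X) v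
  inRange v m with ∈-map⁻ suc (∈-resp-↭ perm m)
  ... | k , k∈ , refl = s≤s z≤n , subst (suc k ≤_) (sym length≡n) (∈-upTo⁻ k∈)

  complete : ∀ v → In[n] (length X) v → v ∈ X
  complete (suc k) (_ , le) = ∈-resp-↭ (↭-sym perm) (∈-map⁺ suc (∈-upTo⁺ (subst (suc k ≤_) length≡n le)))

-- Heap runs ⇔ forest runs ⇔ star-path runs.
mainTheorem5 : (n : ℕ) (X : List ℕ) → IsPermOf n X →
    (𝒫 : List (ℕ × ℕ)) → All (λ p → In[n] n (proj₁ p) × In[n] n (proj₂ p)) 𝒫 →
    HeapAlgWith X 𝒫 ⇔ StarPathAlgWith X 𝒫
mainTheorem5 n X perm 𝒫 _ = run⇔starPath 𝒫 ⇔-∘ heapRun⇔run (initialForest X) 𝒫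
  where
  open Permutation perm
  open Simulation X unique inRange complete
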